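{- Let $\Gamma=\Gamma_1\cdot T$ be a signed graph obtained as the coalescence of a signed graph $\Gamma_1$ and a signed tree $T$. Then $\eta(\Gamma)=\eta(\Gamma_1)$.
   Context: A signed graph $\Gamma=(G,\sigma)$ is a simple graph $G$ with a sign function $\sigma:E(G)\to\{ -1,+1\}$; a signed tree is a signed graph whose underlying graph is a tree. The net Laplacian matrix is $L^{\pm}(\Gamma)=D^{\pm}(\Gamma)-A(\Gamma)$, where $D^{\pm}(\Gamma)$ is the diagonal matrix of net-degrees $d^{\pm}(v)=d^+(v)-d^-(v)$ (numbers of positive minus negative neighbours) and $A(\Gamma)$ is the signed adjacency matrix. $\eta(\Gamma)$ is the multiplicity of $0$ as an eigenvalue of $L^{\pm}(\Gamma)$. The coalescence $\Gamma_1\cdot\Gamma_2$ is obtained from the disjoint union of $\Gamma_1$ and $\Gamma_2$ by identifying a vertex $u$ of $\Gamma_1$ with a vertex $v$ of $\Gamma_2$ into a single vertex $w$, keeping all edges and their signs (edges at $u$ and at $v$ become edges at $w$). -}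

module Defs where

open import Data.Nat using (ℕ; zero; suc) renaming (_+_ to _+ℕ_)
open import Data.Fin using (Fin; zero; suc; inject₁; fromℕ; _↑ˡ_; _↑ʳ_; splitAt; punchIn)
open import Data.Fin.Properties using (_≟_)
open import Data.Sum using (_⊎_; inj₁; inj₂)
open import Data.Product using (Σ; _×_; _,_)
open import Data.Rational using (ℚ; 0ℚ; 1ℚ; -_; _+_; _*_; _-_)
open import Relation.Binary.PropositionalEquality using (_≡_; _≢_)
open import Relation.Nullary using (¬_; yes; no)
open import Function.Definitions using (Injective)

data Entry : Set where
  none pos neg : Entry

Adjacency : ℕ → Set
Adjacency n = Fin n → Fin n → Entry

record IsSignedGraph {n : ℕ} (A : Adjacency n) : Set where
  field
    symmetric : ∀ i j → A i j ≡ A j i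
    loopless  : ∀ i → A i i ≡ none

val : Entry → ℚ
val none = 0ℚ
val pos  = 1ℚ
val neg  = - 1ℚ

sumFin : ∀ {n} → (Fin n → ℚ) → ℚ
sumFin {zero}  f = 0ℚ
sumFin {suc n} f = f zero + sumFin (λ i → f (suc i))

netDeg : ∀ {n} → Adjacency n → Fin n → ℚ
netDeg A i = sumFin (λ j → val (A i j))

Matrix : ℕ → Set
Matrix n = Fin n → Fin n → ℚ

netLaplacian : ∀ {n} → Adjacency n → Matrix n
netLaplacian A i j with i ≟ j
... | yes _ = netDeg A i - val (A i j)
... | no  _ = 0ℚ - val (A i j)

-- Linear algebra over ℚ: multiplicity of the eigenvalue 0 of a
-- (symmetric) matrix = dimension of its kernel.

Vector : ℕ → Set
Vector n = Fin n → ℚ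

_·_ : ∀ {n} → Matrix n → Vector n → Vector n
(M · x) i = sumFin (λ j → M i j * x j)

InKernel : ∀ {n} → Matrix n → Vector n → Set
InKernel M x = ∀ i → (M · x) i ≡ 0ℚ

lincomb : ∀ {k n} → (Fin k → ℚ) → (Fin k → Vector n) → Vector n
lincomb c vs i = sumFin (λ r → c r * vs r i)

LinIndep : ∀ {k n} → (Fin k → Vector n) → Set
LinIndep vs = ∀ c → (∀ i → lincomb c vs i ≡ 0ℚ) → ∀ r → c r ≡ 0ℚ

IsNullity : ∀ {n} → Matrix n → ℕ → Set
IsNullity {n} M d =
  Σ (Fin d → Vector n) λ vs →
    (∀ r → InKernel M (vs r)) ×
    LinIndep vs ×
    (∀ x → InKernel M x → Σ (Fin d → ℚ) λ c → ∀ i → x i ≡ lincomb c vs i)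

η≡ : ∀ {n} → Adjacency n → ℕ → Set
η≡ A d = IsNullity (netLaplacian A) d

Adjacent : ∀ {n} → Adjacency n → Fin n → Fin n → Set
Adjacent A i j = (A i j ≡ pos) ⊎ (A i j ≡ neg)

data Walk {n} (A : Adjacency n) : Fin n → Fin n → Set where
  here : ∀ {i} → Walk A i i
  step : ∀ {i j l} → Adjacent A i j → Walk A j l → Walk A i l

Connected : ∀ {n} → Adjacency n → Set
Connected A = ∀ i j → Walk A i j

record Cycle {n} (A : Adjacency n) : Set where
  field
    len      : ℕ
    vert     : Fin (suc (suc (suc len))) → Fin n
    distinct : Injective _≡_ _≡_ vert
    consec   : ∀ (r : Fin (suc (suc len))) → Adjacent A (vert (inject₁ r)) (vert (suc r))
    closing  : Adjacent A (vert (fromℕ (suc (suc len)))) (vert zero)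

Acyclic : ∀ {n} → Adjacency n → Set
Acyclic A = ¬ Cycle A

-- underlying graph is a tree: connected and acyclic (vertex set nonempty
-- since the index is suc k)
IsTree : ∀ {k} → Adjacency (suc k) → Set
IsTree A = Connected A × Acyclic A

-- Coalescence Γ₁ · T identifying u ∈ V(Γ₁) with v ∈ V(T).
-- Vertex set Fin (n + k): the first n are the vertices of Γ₁ (u plays the
-- role of the merged vertex w), the last k are the vertices of T other
-- than v (vertex r corresponds to punchIn v r).

coalesce : ∀ {n k} → Adjacency n → Adjacency (suc k) → Fin n → Fin (suc k) → Adjacency (n +ℕ k)
coalesce {n} {k} A T u v p q with splitAt n p | splitAt n q
... | inj₁ a | inj₁ b = A a b
... | inj₁ a | inj₂ b with a ≟ u
...   | yes _ = T v (punchIn v b)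
...   | no  _ = none
coalesce {n} {k} A T u v p q | inj₂ a | inj₁ b with b ≟ u
...   | yes _ = T (punchIn v a) v
...   | no  _ = none
coalesce {n} {k} A T u v p q | inj₂ a | inj₂ b = T (punchIn v a) (punchIn v b)

{-# OPTIONS --safe #-}
module Submission where

-- Row i of the net Laplacian applied to x is the net flow Σⱼ σ(ij)(xᵢ − xⱼ) out of i, so the
-- kernel consists of the vectors whose flow is conserved at every vertex. Restriction to Γ₁ and
-- extension by the value at u are then inverse linear maps between the two kernels. The only
-- nontrivial point is that a kernel vector y of Γ₁ · T is constant on T: its flow is conserved
-- at every vertex of T except the merged one, hence there as well, because the total net flow
-- of a symmetric graph vanishes; and a conserved flow that is nonzero on some edge can always
-- be continued along a different edge, producing a non-backtracking walk and thus a cycle in T.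

open import Defs
open import Algebra.Bundles using (CommutativeRing)
open import Data.Empty using (⊥-elim)
open import Data.Fin as Fin
  using (Fin; zero; suc; toℕ; fromℕ<; _↑ˡ_; _↑ʳ_; splitAt; punchIn; punchOut)
open import Data.Fin.Properties
  using (any?; pigeonhole; toℕ<n; toℕ-injective; toℕ-fromℕ; toℕ-fromℕ<; toℕ-inject₁;
         splitAt-↑ˡ; splitAt-↑ʳ; join-splitAt; splitAt⁻¹-↑ˡ; splitAt⁻¹-↑ʳ;
         punchInᵢ≢i; punchIn-punchOut; punchOut-cong; punchOut-punchIn)
  renaming (_≟_ to _≟ᶠ_)
open import Data.Nat as ℕ using (ℕ; zero; suc)
import Data.Nat.Properties as ℕ
open import Data.Product using (Σ-syntax; ∃₂; _×_; _,_; proj₁; proj₂)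
open import Data.Rational using (ℚ; 0ℚ; 1ℚ; ½; -_; _+_; _*_; _-_)
open import Data.Rational.Properties
  using (+-identityˡ; +-identityʳ; +-assoc; +-inverseʳ; *-identityˡ; *-zeroˡ; *-zeroʳ;
         +-0-group; +-*-commutativeRing)
  renaming (_≟_ to _≟ℚ_)
open import Data.Rational.Solver using (module +-*-Solver)
open import Data.Sum using (_⊎_; inj₁; inj₂; [_,_]; [_,_]′)
open import Function using (_∘_; const)
open import Function.Bundles using (_⇔_; mk⇔)
open import Relation.Binary.PropositionalEquality hiding ([_])
open import Relation.Nullary using (¬_; yes; no)
open import Relation.Nullary.Decidable using (_×-dec_; ¬?; decidable-stable)
open import Relation.Nullary.Negation using (contradiction)

open import Algebra.Properties.Group +-0-group using (x∙y⁻¹≈ε⇒x≈y)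
open import Algebra.Properties.Semiring.Sum (CommutativeRing.semiring +-*-commutativeRing)
  using (sum; sum-cong-≗; sum-replicate-zero; sum-remove; ∑-distrib-+; ∑-comm; *-distribʳ-sum)
open +-*-Solver
open ≡-Reasoning

sumFin≡sum : ∀ {n} (f : Fin n → ℚ) → sumFin f ≡ sum f
sumFin≡sum {zero}  f = refl
sumFin≡sum {suc n} f = cong (f zero +_) (sumFin≡sum (f ∘ suc))

sum-zero : ∀ {n} {f : Fin n → ℚ} → (∀ i → f i ≡ 0ℚ) → sum f ≡ 0ℚ
sum-zero {n} f≡0 = trans (sum-cong-≗ f≡0) (sum-replicate-zero n)

sum-single : ∀ {n} {f : Fin n → ℚ} i → (∀ j → j ≢ i → f j ≡ 0ℚ) → sum f ≡ f i
sum-single {suc n} {f} i off = begin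
  sum f                              ≡⟨ sum-remove f ⟩
  f i + sum (f ∘ punchIn i)          ≡⟨ cong (f i +_) (sum-zero λ j → off (punchIn i j) (punchInᵢ≢i i j)) ⟩
  f i + 0ℚ                           ≡⟨ +-identityʳ (f i) ⟩
  f i                                ∎

sum-↑ : ∀ m {n} (f : Fin (m ℕ.+ n) → ℚ) → sum f ≡ sum (f ∘ (_↑ˡ n)) + sum (f ∘ (m ↑ʳ_))
sum-↑ zero    f = sym (+-identityˡ (sum f))
sum-↑ (suc m) f = trans (cong (f zero +_) (sum-↑ m (f ∘ suc))) (sym (+-assoc (f zero) _ _))

x+x≡0⇒x≡0 : ∀ x → x + x ≡ 0ℚ → x ≡ 0ℚ
x+x≡0⇒x≡0 x x+x≡0 = begin
  x             ≡⟨ solve 1 (λ x → x := con ½ :* (x :+ x)) refl x ⟩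
  ½ * (x + x)   ≡⟨ cong (½ *_) x+x≡0 ⟩
  ½ * 0ℚ        ≡⟨ *-zeroʳ ½ ⟩
  0ℚ            ∎

flow : ∀ {n} → Adjacency n → Vector n → Fin n → Fin n → ℚ
flow A x i j = val (A i j) * (x i - x j)

netFlow : ∀ {n} → Adjacency n → Vector n → Fin n → ℚ
netFlow A x i = sum (flow A x i)

Balanced : ∀ {n} → Adjacency n → Vector n → Set
Balanced A x = ∀ i → netFlow A x i ≡ 0ℚ

netLaplacian-·≡netFlow : ∀ {n} (A : Adjacency n) x i → (netLaplacian A · x) i ≡ netFlow A x i
netLaplacian-·≡netFlow {n} A x i = begin
  (netLaplacian A · x) i                          ≡⟨ sumFin≡sum (λ j → netLaplacian A i j * x j) ⟩
  sum (λ j → netLaplacian A i j * x j)            ≡⟨ sum-cong-≗ entry ⟩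
  sum (λ j → diagonal j + - (val (A i j) * x j))  ≡⟨ ∑-distrib-+ diagonal _ ⟩
  sum diagonal + sum (λ j → - (val (A i j) * x j))
    ≡⟨ cong (_+ sum (λ j → - (val (A i j) * x j))) (trans (sum-single i diagonal-off) diagonal-on) ⟩
  netDeg A i * x i + sum (λ j → - (val (A i j) * x j))
    ≡⟨ cong (λ d → d * x i + sum (λ j → - (val (A i j) * x j))) (sumFin≡sum (val ∘ A i)) ⟩
  sum (val ∘ A i) * x i + sum (λ j → - (val (A i j) * x j))
    ≡⟨ cong (_+ sum (λ j → - (val (A i j) * x j))) (*-distribʳ-sum (x i) (val ∘ A i)) ⟩
  sum (λ j → val (A i j) * x i) + sum (λ j → - (val (A i j) * x j))
    ≡⟨ ∑-distrib-+ (λ j → val (A i j) * x i) _ ⟨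
  sum (λ j → val (A i j) * x i + - (val (A i j) * x j))
    ≡⟨ sum-cong-≗ (λ j → solve 3 (λ a y z → a :* y :+ :- (a :* z) := a :* (y :- z)) refl (val (A i j)) (x i) (x j)) ⟩
  netFlow A x i                                   ∎
  where
  diagonal : Fin n → ℚ
  diagonal j with i ≟ᶠ j
  ... | yes _ = netDeg A i * x i
  ... | no  _ = 0ℚ

  diagonal-off : ∀ j → j ≢ i → diagonal j ≡ 0ℚ
  diagonal-off j j≢i with i ≟ᶠ j
  ... | yes i≡j = contradiction (sym i≡j) j≢i
  ... | no  _   = refl

  diagonal-on : diagonal i ≡ netDeg A i * x i
  diagonal-on with i ≟ᶠ i
  ... | yes _   = refl
  ... | no  i≢i = contradiction refl i≢i

  entry : ∀ j → netLaplacian A i j * x j ≡ diagonal j + - (val (A i j) * x j)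
  entry j with i ≟ᶠ j
  ... | yes refl = solve 3 (λ d a y → (d :- a) :* y := d :* y :+ :- (a :* y)) refl (netDeg A i) (val (A i i)) (x i)
  ... | no  _    = solve 2 (λ a y → (con 0ℚ :- a) :* y := con 0ℚ :+ :- (a :* y)) refl (val (A i j)) (x j)

inKernel⇒balanced : ∀ {n} (A : Adjacency n) {x} → InKernel (netLaplacian A) x → Balanced A x
inKernel⇒balanced A {x} Lx≡0 i = trans (sym (netLaplacian-·≡netFlow A x i)) (Lx≡0 i)

balanced⇒inKernel : ∀ {n} (A : Adjacency n) {x} → Balanced A x → InKernel (netLaplacian A) x
balanced⇒inKernel A {x} bal i = trans (netLaplacian-·≡netFlow A x i) (bal i)

Symmetric : ∀ {n} → Adjacency n → Set
Symmetric A = ∀ i j → A i j ≡ A j i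

flow-antisym : ∀ {n} {A : Adjacency n} → Symmetric A → ∀ x i j → flow A x i j + flow A x j i ≡ 0ℚ
flow-antisym {A = A} sym-A x i j rewrite sym-A j i =
  solve 3 (λ a y z → a :* (y :- z) :+ a :* (z :- y) := con 0ℚ) refl (val (A i j)) (x i) (x j)

totalNetFlow≡0 : ∀ {n} {A : Adjacency n} → Symmetric A → ∀ x → sum (netFlow A x) ≡ 0ℚ
totalNetFlow≡0 {n} {A} sym-A x = x+x≡0⇒x≡0 (sum (netFlow A x)) (begin
  sum (λ i → sum (f i)) + sum (λ i → sum (f i))          ≡⟨ cong (sum (λ i → sum (f i)) +_) (∑-comm f) ⟩
  sum (λ i → sum (f i)) + sum (λ i → sum (λ j → f j i))  ≡⟨ ∑-distrib-+ (λ i → sum (f i)) _ ⟨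
  sum (λ i → sum (f i) + sum (λ j → f j i))              ≡⟨ sum-cong-≗ (λ i → ∑-distrib-+ (f i) _) ⟨
  sum (λ i → sum (λ j → f i j + f j i))                  ≡⟨ sum-zero (λ i → sum-zero (flow-antisym sym-A x i)) ⟩
  0ℚ                                                     ∎)
  where
  f : Fin n → Fin n → ℚ
  f = flow A x

balanced-punchIn : ∀ {n} {A : Adjacency (suc n)} {x} → Symmetric A →
  ∀ v → (∀ t → netFlow A x (punchIn v t) ≡ 0ℚ) → Balanced A x
balanced-punchIn {A = A} {x} sym-A v off w with v ≟ᶠ w
... | yes refl = begin
  netFlow A x v                                       ≡⟨ +-identityʳ (netFlow A x v) ⟨
  netFlow A x v + 0ℚ                                  ≡⟨ cong (netFlow A x v +_) (sum-zero off) ⟨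
  netFlow A x v + sum (netFlow A x ∘ punchIn v)       ≡⟨ sum-remove (netFlow A x) ⟨
  sum (netFlow A x)                                   ≡⟨ totalNetFlow≡0 sym-A x ⟩
  0ℚ                                                  ∎
... | no v≢w = subst (λ w → netFlow A x w ≡ 0ℚ) (punchIn-punchOut v≢w) (off (punchOut v≢w))

flow-equal : ∀ {n} (A : Adjacency n) x {i j} → x i ≡ x j → flow A x i j ≡ 0ℚ
flow-equal A x {i} {j} xi≡xj = begin
  val (A i j) * (x i - x j)  ≡⟨ cong (λ y → val (A i j) * (x i - y)) xi≡xj ⟨
  val (A i j) * (x i - x i)  ≡⟨ cong (val (A i j) *_) (+-inverseʳ (x i)) ⟩
  val (A i j) * 0ℚ           ≡⟨ *-zeroʳ (val (A i j)) ⟩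
  0ℚ                         ∎

flow-none : ∀ {n} {A : Adjacency n} x {i j} → A i j ≡ none → flow A x i j ≡ 0ℚ
flow-none x {i} {j} Aij≡none rewrite Aij≡none = *-zeroˡ (x i - x j)

flow-cong : ∀ {m n} (A : Adjacency m) (B : Adjacency n) x y {i j i′ j′} →
  A i j ≡ B i′ j′ → x i ≡ y i′ → x j ≡ y j′ → flow A x i j ≡ flow B y i′ j′
flow-cong A B x y e ei ej = cong₂ (λ a d → val a * d) e (cong₂ _-_ ei ej)

val-*≡0 : ∀ {e} d → (e ≡ pos) ⊎ (e ≡ neg) → val e * d ≡ 0ℚ → d ≡ 0ℚ
val-*≡0 d (inj₁ refl) 1d≡0 = trans (sym (*-identityˡ d)) 1d≡0
val-*≡0 d (inj₂ refl) -d≡0 = begin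
  d               ≡⟨ solve 1 (λ d → d := :- (:- con 1ℚ :* d)) refl d ⟩
  - (- 1ℚ * d)    ≡⟨ cong -_ -d≡0 ⟩
  0ℚ              ∎

Active : ∀ {n} → Adjacency n → Vector n → Fin n → Fin n → Set
Active A x i j = Adjacent A i j × x i ≢ x j

active⇒flow≢0 : ∀ {n} {A : Adjacency n} {x i j} → Active A x i j → flow A x i j ≢ 0ℚ
active⇒flow≢0 {x = x} {i} {j} (adj , xi≢xj) flow≡0 =
  xi≢xj (x∙y⁻¹≈ε⇒x≈y (x i) (x j) (val-*≡0 (x i - x j) adj flow≡0))

flow≢0⇒active : ∀ {n} {A : Adjacency n} {x i j} → flow A x i j ≢ 0ℚ → Active A x i j
flow≢0⇒active {A = A} {x} {i} {j} flow≢0 = adjacent (A i j) refl , flow≢0 ∘ flow-equal A x {i} {j}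
  where
  adjacent : ∀ e → A i j ≡ e → Adjacent A i j
  adjacent none Aij≡none = contradiction (flow-none {A = A} x Aij≡none) flow≢0
  adjacent pos  Aij≡pos  = inj₁ Aij≡pos
  adjacent neg  Aij≡neg  = inj₂ Aij≡neg

adjacent-sym : ∀ {n} {A : Adjacency n} → Symmetric A → ∀ {i j} → Adjacent A i j → Adjacent A j i
adjacent-sym sym-A {i} {j} (inj₁ Aij≡pos) = inj₁ (trans (sym-A j i) Aij≡pos)
adjacent-sym sym-A {i} {j} (inj₂ Aij≡neg) = inj₂ (trans (sym-A j i) Aij≡neg)

-- Flow is conserved at b, so the nonzero flow from b to a is compensated along another edge.
active-continues : ∀ {n} {A : Adjacency n} {x} → Symmetric A → Balanced A x →
  ∀ {a b} → Active A x a b → Σ[ c ∈ Fin n ] Active A x b c × c ≢ a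
active-continues {A = A} {x} sym-A bal {a} {b} (adj , xa≢xb)
  with any? (λ c → ¬? (c ≟ᶠ a) ×-dec ¬? (flow A x b c ≟ℚ 0ℚ))
... | yes (c , c≢a , flow≢0) = c , flow≢0⇒active {A = A} flow≢0 , c≢a
... | no  none-else = ⊥-elim (active⇒flow≢0 {A = A} back (trans (sym (sum-single a only-a)) (bal b)))
  where
  back : Active A x b a
  back = adjacent-sym sym-A adj , xa≢xb ∘ sym

  only-a : ∀ c → c ≢ a → flow A x b c ≡ 0ℚ
  only-a c c≢a = decidable-stable (flow A x b c ≟ℚ 0ℚ) (λ flow≢0 → none-else (c , c≢a , flow≢0))

InjectiveBelow : ∀ {m} → (ℕ → Fin m) → ℕ → Set
InjectiveBelow s N = ∀ {p q} → p ℕ.< N → q ℕ.< N → s p ≡ s q → p ≡ q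

record FirstRepeat {m} (s : ℕ → Fin m) : Set where
  field
    start gap       : ℕ
    repeats         : s (start ℕ.+ suc gap) ≡ s start
    injectiveBefore : InjectiveBelow s (start ℕ.+ suc gap)

injectiveBelow⊎firstRepeat : ∀ {m} (s : ℕ → Fin m) N → InjectiveBelow s N ⊎ FirstRepeat s
injectiveBelow⊎firstRepeat s zero = inj₁ (λ ())
injectiveBelow⊎firstRepeat s (suc N) with injectiveBelow⊎firstRepeat s N
... | inj₂ r = inj₂ r
... | inj₁ inj with any? (λ (p : Fin N) → s (toℕ p) ≟ᶠ s N)
...   | yes (p , sp≡sN) = inj₂ record
  { start = toℕ p ; gap = N ℕ.∸ suc (toℕ p)
  ; repeats = subst (λ M → s M ≡ s (toℕ p)) (sym p+gap≡N) (sym sp≡sN)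
  ; injectiveBefore = subst (InjectiveBelow s) (sym p+gap≡N) inj
  }
  where
  p+gap≡N : toℕ p ℕ.+ suc (N ℕ.∸ suc (toℕ p)) ≡ N
  p+gap≡N = trans (ℕ.+-suc (toℕ p) _) (ℕ.m+[n∸m]≡n (toℕ<n p))
...   | no new = inj₁ inj′
  where
  old : ∀ {p} → p ℕ.< N → s p ≢ s N
  old p<N sp≡sN = new (fromℕ< p<N , trans (cong s (toℕ-fromℕ< p<N)) sp≡sN)

  inj′ : InjectiveBelow s (suc N)
  inj′ {p} {q} p<1+N q<1+N sp≡sq with ℕ.m≤n⇒m<n∨m≡n (ℕ.s≤s⁻¹ p<1+N) | ℕ.m≤n⇒m<n∨m≡n (ℕ.s≤s⁻¹ q<1+N)
  ... | inj₁ p<N  | inj₁ q<N  = inj p<N q<N sp≡sq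
  ... | inj₁ p<N  | inj₂ refl = contradiction sp≡sq (old p<N)
  ... | inj₂ refl | inj₁ q<N  = contradiction (sym sp≡sq) (old q<N)
  ... | inj₂ refl | inj₂ refl = refl

firstRepeat : ∀ {m} (s : ℕ → Fin m) → FirstRepeat s
firstRepeat {m} s with injectiveBelow⊎firstRepeat s (suc m)
... | inj₂ r   = r
... | inj₁ inj with pigeonhole (ℕ.n<1+n m) (s ∘ toℕ)
...   | i , j , i<j , si≡sj = contradiction (inj (toℕ<n i) (toℕ<n j) si≡sj) (ℕ.<⇒≢ i<j)

record NonBacktrackingWalk {n} (A : Adjacency n) : Set where
  field
    vertex       : ℕ → Fin n
    adjacent     : ∀ i → Adjacent A (vertex i) (vertex (suc i))
    no-backtrack : ∀ i → vertex (suc (suc i)) ≢ vertex i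

adjacent-irrefl : ∀ {n} {A : Adjacency n} → (∀ i → A i i ≡ none) → ∀ i → ¬ Adjacent A i i
adjacent-irrefl loopless i (inj₁ Aii≡pos) with () ← trans (sym (loopless i)) Aii≡pos
adjacent-irrefl loopless i (inj₂ Aii≡neg) with () ← trans (sym (loopless i)) Aii≡neg

-- The closed stretch between the first repetition and its earlier occurrence is a cycle;
-- it has length at least 3 because the walk neither stays nor turns back.
nonBacktrackingWalk⇒cycle : ∀ {n} {A : Adjacency n} → (∀ i → A i i ≡ none) →
  NonBacktrackingWalk A → Cycle A
nonBacktrackingWalk⇒cycle {n} {A} loopless w = fromRepeat (firstRepeat vertex)
  where
  open NonBacktrackingWalk w

  fromRepeat : FirstRepeat vertex → Cycle A
  fromRepeat record { start = i ; gap = zero ; repeats = repeats } =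
    ⊥-elim (adjacent-irrefl {A = A} loopless (vertex i)
      (subst (Adjacent A (vertex i)) (trans (cong vertex (ℕ.+-comm 1 i)) repeats) (adjacent i)))
  fromRepeat record { start = i ; gap = suc zero ; repeats = repeats } =
    ⊥-elim (no-backtrack i (trans (cong vertex (ℕ.+-comm 2 i)) repeats))
  fromRepeat record { start = i ; gap = suc (suc m) ; repeats = repeats ; injectiveBefore = inj } = record
    { len      = m
    ; vert     = vert
    ; distinct = λ {r} {r′} eq → toℕ-injective (ℕ.+-cancelˡ-≡ i _ _
        (inj (ℕ.+-monoʳ-< i (toℕ<n r)) (ℕ.+-monoʳ-< i (toℕ<n r′)) eq))
    ; consec   = λ r → subst₂ (λ p q → Adjacent A (vertex p) (vertex q))
        (cong (i ℕ.+_) (sym (toℕ-inject₁ r))) (sym (ℕ.+-suc i (toℕ r))) (adjacent (i ℕ.+ toℕ r))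
    ; closing  = subst₂ (λ p q → Adjacent A (vertex p) q)
        (cong (i ℕ.+_) (sym (toℕ-fromℕ (suc (suc m)))))
        (trans (cong vertex (sym (ℕ.+-suc i (suc (suc m))))) (trans repeats (cong vertex (sym (ℕ.+-identityʳ i)))))
        (adjacent (i ℕ.+ suc (suc m)))
    }
    where
    vert : Fin (suc (suc (suc m))) → Fin n
    vert r = vertex (i ℕ.+ toℕ r)

activeWalk : ∀ {n} {A : Adjacency n} {x} → Symmetric A → Balanced A x →
  ∀ {a b} → Active A x a b → NonBacktrackingWalk A
activeWalk {n} {A} {x} sym-A bal {a₀} {b₀} e₀ = record
  { vertex       = proj₁ ∘ state
  ; adjacent     = λ i → proj₁ (proj₂ (proj₂ (state i)))
  ; no-backtrack = λ i → proj₂ (proj₂ (continue (proj₂ (proj₂ (state i)))))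
  }
  where
  ActiveEdge : Set
  ActiveEdge = Σ[ a ∈ Fin n ] Σ[ b ∈ Fin n ] Active A x a b

  continue : ∀ {a b} → Active A x a b → Σ[ c ∈ Fin n ] Active A x b c × c ≢ a
  continue = active-continues sym-A bal

  state : ℕ → ActiveEdge
  state zero    = a₀ , b₀ , e₀
  state (suc i) with state i
  ... | a , b , e = b , proj₁ (continue e) , proj₁ (proj₂ (continue e))

walk⇒active : ∀ {n} {A : Adjacency n} x {a b} → Walk A a b → x a ≢ x b → ∃₂ (Active A x)
walk⇒active x here                     xa≢xa = contradiction refl xa≢xa
walk⇒active x (step {i} {j} adj walk) xi≢xl with x i ≟ℚ x j
... | yes xi≡xj = walk⇒active x walk (xi≢xl ∘ trans xi≡xj)
... | no  xi≢xj = i , j , adj , xi≢xj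

balanced-tree⇒constant : ∀ {k} {T : Adjacency (suc k)} {x} → IsSignedGraph T → IsTree T →
  Balanced T x → ∀ i j → x i ≡ x j
balanced-tree⇒constant {x = x} sg (connected , acyclic) bal i j with x i ≟ℚ x j
... | yes xi≡xj = xi≡xj
... | no  xi≢xj with walk⇒active x (connected i j) xi≢xj
...   | _ , _ , e = contradiction
  (nonBacktrackingWalk⇒cycle loopless (activeWalk symmetric bal e)) acyclic
  where open IsSignedGraph sg

lincomb-cong : ∀ {d n} (c : Fin d → ℚ) {vs ws : Fin d → Vector n} →
  (∀ r → ∀ i → vs r i ≡ ws r i) → ∀ i → lincomb c vs i ≡ lincomb c ws i
lincomb-cong c {vs} {ws} vs≗ws i = begin
  lincomb c vs i                 ≡⟨ sumFin≡sum (λ r → c r * vs r i) ⟩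
  sum (λ r → c r * vs r i)       ≡⟨ sum-cong-≗ (λ r → cong (c r *_) (vs≗ws r i)) ⟩
  sum (λ r → c r * ws r i)       ≡⟨ sumFin≡sum (λ r → c r * ws r i) ⟨
  lincomb c ws i                 ∎

record KernelIsomorphism {m n} (M : Matrix m) (N : Matrix n) : Set where
  field
    to          : Vector m → Vector n
    from        : Vector n → Vector m
    to-kernel   : ∀ x → InKernel M x → InKernel N (to x)
    from-kernel : ∀ y → InKernel N y → InKernel M (from y)
    to-cong     : ∀ {x x′} → (∀ i → x i ≡ x′ i) → ∀ j → to x j ≡ to x′ j
    from-cong   : ∀ {y y′} → (∀ j → y j ≡ y′ j) → ∀ i → from y i ≡ from y′ i
    to-lincomb   : ∀ {d} c (xs : Fin d → Vector m) j → to (lincomb c xs) j ≡ lincomb c (to ∘ xs) j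
    from-lincomb : ∀ {d} c (ys : Fin d → Vector n) i → from (lincomb c ys) i ≡ lincomb c (from ∘ ys) i
    from-to     : ∀ x → InKernel M x → ∀ i → from (to x) i ≡ x i
    to-from     : ∀ y → InKernel N y → ∀ j → to (from y) j ≡ y j

KernelIsomorphism-sym : ∀ {m n} {M : Matrix m} {N : Matrix n} →
  KernelIsomorphism M N → KernelIsomorphism N M
KernelIsomorphism-sym iso = record
  { to = from ; from = to ; to-kernel = from-kernel ; from-kernel = to-kernel
  ; to-cong = from-cong ; from-cong = to-cong ; to-lincomb = from-lincomb ; from-lincomb = to-lincomb
  ; from-to = to-from ; to-from = from-to
  }
  where open KernelIsomorphism iso

isNullity-transport : ∀ {m n} {M : Matrix m} {N : Matrix n} {d} →
  KernelIsomorphism M N → IsNullity M d → IsNullity N d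
isNullity-transport {M = M} {N} {d} iso (vs , vs-kernel , vs-independent , vs-span) =
  to ∘ vs , (λ r → to-kernel (vs r) (vs-kernel r)) , independent , span
  where
  open KernelIsomorphism iso

  independent : LinIndep (to ∘ vs)
  independent c comb≡0 = vs-independent c λ i → begin
    lincomb c vs i                   ≡⟨ lincomb-cong c (λ r → from-to (vs r) (vs-kernel r)) i ⟨
    lincomb c (from ∘ to ∘ vs) i     ≡⟨ from-lincomb c (to ∘ vs) i ⟨
    from (lincomb c (to ∘ vs)) i     ≡⟨ from-cong comb≡0 i ⟩
    from (λ _ → 0ℚ) i                ≡⟨ from-lincomb {zero} (λ ()) (λ ()) i ⟩  -- the empty combination
    0ℚ                               ∎

  span : ∀ y → InKernel N y → Σ[ c ∈ (Fin d → ℚ) ] ∀ j → y j ≡ lincomb c (to ∘ vs) j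
  span y y-kernel = c , λ j → begin
    y j                      ≡⟨ to-from y y-kernel j ⟨
    to (from y) j            ≡⟨ to-cong from-y≗comb j ⟩
    to (lincomb c vs) j      ≡⟨ to-lincomb c vs j ⟩
    lincomb c (to ∘ vs) j    ∎
    where
    c : Fin d → ℚ
    c = proj₁ (vs-span (from y) (from-kernel y y-kernel))

    from-y≗comb : ∀ i → from y i ≡ lincomb c vs i
    from-y≗comb = proj₂ (vs-span (from y) (from-kernel y y-kernel))

isNullity-⇔ : ∀ {m n} {M : Matrix m} {N : Matrix n} →
  KernelIsomorphism M N → ∀ d → IsNullity M d ⇔ IsNullity N d
isNullity-⇔ iso d = mk⇔ (isNullity-transport iso) (isNullity-transport (KernelIsomorphism-sym iso))

netFlow-cong : ∀ {n} (A : Adjacency n) x y → (∀ i → x i ≡ y i) → ∀ i → netFlow A x i ≡ netFlow A y i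
netFlow-cong A x y x≗y i = sum-cong-≗ (λ j → flow-cong A A x y refl (x≗y i) (x≗y j))

↑-elim : ∀ {m n} (P : Fin (m ℕ.+ n) → Set) → (∀ a → P (a ↑ˡ n)) → (∀ t → P (m ↑ʳ t)) → ∀ p → P p
↑-elim {m} {n} P left right p =
  subst P (join-splitAt m n p) ([_,_] {C = P ∘ Fin.join m n} left right (splitAt m p))

module Coalescence {n k} (A : Adjacency n) (T : Adjacency (suc k)) (u : Fin n) (v : Fin (suc k)) where

  Γ : Adjacency (n ℕ.+ k)
  Γ = coalesce A T u v

  coalesce-↑ˡ-↑ˡ : ∀ a b → Γ (a ↑ˡ k) (b ↑ˡ k) ≡ A a b
  coalesce-↑ˡ-↑ˡ a b rewrite splitAt-↑ˡ n a k | splitAt-↑ˡ n b k = refl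

  coalesce-↑ʳ-↑ʳ : ∀ t t′ → Γ (n ↑ʳ t) (n ↑ʳ t′) ≡ T (punchIn v t) (punchIn v t′)
  coalesce-↑ʳ-↑ʳ t t′ rewrite splitAt-↑ʳ n k t | splitAt-↑ʳ n k t′ = refl

  coalesce-↑ʳ-u : ∀ t → Γ (n ↑ʳ t) (u ↑ˡ k) ≡ T (punchIn v t) v
  coalesce-↑ʳ-u t rewrite splitAt-↑ˡ n u k | splitAt-↑ʳ n k t with u ≟ᶠ u
  ... | yes _   = refl
  ... | no  u≢u = contradiction refl u≢u

  coalesce-↑ˡ-↑ʳ : ∀ {a} t → a ≢ u → Γ (a ↑ˡ k) (n ↑ʳ t) ≡ none
  coalesce-↑ˡ-↑ʳ {a} t a≢u rewrite splitAt-↑ˡ n a k | splitAt-↑ʳ n k t with a ≟ᶠ u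
  ... | yes a≡u = contradiction a≡u a≢u
  ... | no  _   = refl

  coalesce-↑ʳ-↑ˡ : ∀ {b} t → b ≢ u → Γ (n ↑ʳ t) (b ↑ˡ k) ≡ none
  coalesce-↑ʳ-↑ˡ {b} t b≢u rewrite splitAt-↑ˡ n b k | splitAt-↑ʳ n k t with b ≟ᶠ u
  ... | yes b≡u = contradiction b≡u b≢u
  ... | no  _   = refl

  TreeConstant : Vector (n ℕ.+ k) → Set
  TreeConstant y = ∀ t → y (n ↑ʳ t) ≡ y (u ↑ˡ k)

  restrict : Vector (n ℕ.+ k) → Vector n
  restrict y a = y (a ↑ˡ k)

  extend : Vector n → Vector (n ℕ.+ k)
  extend x p = [ x , const (x u) ]′ (splitAt n p)

  -- y read on the vertices of T, the merged vertex v carrying the value of u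
  treePart : Vector (n ℕ.+ k) → Vector (suc k)
  treePart y s with v ≟ᶠ s
  ... | yes _   = y (u ↑ˡ k)
  ... | no  v≢s = y (n ↑ʳ punchOut v≢s)

  treePart-v : ∀ y → treePart y v ≡ y (u ↑ˡ k)
  treePart-v y with v ≟ᶠ v
  ... | yes _   = refl
  ... | no  v≢v = contradiction refl v≢v

  treePart-punchIn : ∀ y t → treePart y (punchIn v t) ≡ y (n ↑ʳ t)
  treePart-punchIn y t with v ≟ᶠ punchIn v t
  ... | yes v≡t = contradiction (sym v≡t) (punchInᵢ≢i v t)
  ... | no  _   = cong (λ t′ → y (n ↑ʳ t′)) (trans (punchOut-cong v refl) (punchOut-punchIn v))

  treePart-constant : ∀ {y} → TreeConstant y → ∀ s → treePart y s ≡ y (u ↑ˡ k)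
  treePart-constant {y} y-const s with v ≟ᶠ s
  ... | yes _   = refl
  ... | no  v≢s = y-const (punchOut v≢s)

  netFlow-↑ʳ : ∀ y t → netFlow Γ y (n ↑ʳ t) ≡ netFlow T (treePart y) (punchIn v t)
  netFlow-↑ʳ y t = begin
    netFlow Γ y (n ↑ʳ t)
      ≡⟨ sum-↑ n (flow Γ y (n ↑ʳ t)) ⟩
    sum (λ b → flow Γ y (n ↑ʳ t) (b ↑ˡ k)) + sum (λ t′ → flow Γ y (n ↑ʳ t) (n ↑ʳ t′))
      ≡⟨ cong (_+ sum (λ t′ → flow Γ y (n ↑ʳ t) (n ↑ʳ t′)))
           (sum-single u (λ b b≢u → flow-none {A = Γ} y (coalesce-↑ʳ-↑ˡ t b≢u))) ⟩
    flow Γ y (n ↑ʳ t) (u ↑ˡ k) + sum (λ t′ → flow Γ y (n ↑ʳ t) (n ↑ʳ t′))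
      ≡⟨ cong₂ _+_ (flow-cong Γ T y z (coalesce-↑ʳ-u t) (sym (treePart-punchIn y t)) (sym (treePart-v y)))
                   (sum-cong-≗ λ t′ → flow-cong Γ T y z (coalesce-↑ʳ-↑ʳ t t′)
                                        (sym (treePart-punchIn y t)) (sym (treePart-punchIn y t′))) ⟩
    flow T z (punchIn v t) v + sum (flow T z (punchIn v t) ∘ punchIn v)
      ≡⟨ sum-remove (flow T z (punchIn v t)) ⟨
    netFlow T z (punchIn v t)
      ∎
    where
    z : Vector (suc k)
    z = treePart y

  netFlow-↑ˡ : ∀ y → TreeConstant y → ∀ a → netFlow Γ y (a ↑ˡ k) ≡ netFlow A (restrict y) a
  netFlow-↑ˡ y y-const a = begin
    netFlow Γ y (a ↑ˡ k)
      ≡⟨ sum-↑ n (flow Γ y (a ↑ˡ k)) ⟩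
    sum (λ b → flow Γ y (a ↑ˡ k) (b ↑ˡ k)) + sum (λ t → flow Γ y (a ↑ˡ k) (n ↑ʳ t))
      ≡⟨ cong₂ _+_ (sum-cong-≗ λ b → flow-cong Γ A y (restrict y) (coalesce-↑ˡ-↑ˡ a b) refl refl)
                   (sum-zero tree-flow≡0) ⟩
    netFlow A (restrict y) a + 0ℚ
      ≡⟨ +-identityʳ _ ⟩
    netFlow A (restrict y) a
      ∎
    where
    tree-flow≡0 : ∀ t → flow Γ y (a ↑ˡ k) (n ↑ʳ t) ≡ 0ℚ
    tree-flow≡0 t with a ≟ᶠ u
    ... | yes refl = flow-equal Γ y (sym (y-const t))
    ... | no  a≢u  = flow-none {A = Γ} y (coalesce-↑ˡ-↑ʳ t a≢u)

  restrict-extend : ∀ x a → restrict (extend x) a ≡ x a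
  restrict-extend x a = cong [ x , const (x u) ]′ (splitAt-↑ˡ n a k)

  extend-treeConstant : ∀ x → TreeConstant (extend x)
  extend-treeConstant x t = trans (cong [ x , const (x u) ]′ (splitAt-↑ʳ n k t)) (sym (restrict-extend x u))

  extend-restrict : ∀ {y} → TreeConstant y → ∀ p → extend (restrict y) p ≡ y p
  extend-restrict {y} y-const p with splitAt n p in eq
  ... | inj₁ a = cong y (splitAt⁻¹-↑ˡ eq)
  ... | inj₂ t = trans (sym (y-const t)) (cong y (splitAt⁻¹-↑ʳ eq))

  extend-cong : ∀ {x x′} → (∀ a → x a ≡ x′ a) → ∀ p → extend x p ≡ extend x′ p
  extend-cong x≗x′ p with splitAt n p
  ... | inj₁ a = x≗x′ a
  ... | inj₂ _ = x≗x′ u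

  extend-lincomb : ∀ {d} c (xs : Fin d → Vector n) p → extend (lincomb c xs) p ≡ lincomb c (extend ∘ xs) p
  extend-lincomb c xs p with splitAt n p
  ... | inj₁ _ = refl
  ... | inj₂ _ = refl

  treeConstant-balanced : ∀ y → TreeConstant y → Balanced A (restrict y) → Balanced Γ y
  treeConstant-balanced y y-const bal = ↑-elim (λ p → netFlow Γ y p ≡ 0ℚ)
    (λ a → trans (netFlow-↑ˡ y y-const a) (bal a))
    (λ t → begin
      netFlow Γ y (n ↑ʳ t)                         ≡⟨ netFlow-↑ʳ y t ⟩
      netFlow T (treePart y) (punchIn v t)
        ≡⟨ netFlow-cong T (treePart y) (const (y (u ↑ˡ k))) (treePart-constant y-const) (punchIn v t) ⟩
      netFlow T (const (y (u ↑ˡ k))) (punchIn v t)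
        ≡⟨ sum-zero (λ s → flow-equal T (const (y (u ↑ˡ k))) {punchIn v t} {s} refl) ⟩
      0ℚ                                           ∎)

  extend-balanced : ∀ x → Balanced A x → Balanced Γ (extend x)
  extend-balanced x bal = treeConstant-balanced (extend x) (extend-treeConstant x)
    (λ a → trans (netFlow-cong A (restrict (extend x)) x (restrict-extend x) a) (bal a))

  balanced⇒treeConstant : IsSignedGraph T → IsTree T → ∀ y → Balanced Γ y → TreeConstant y
  balanced⇒treeConstant sg tree y bal t = begin
    y (n ↑ʳ t)                 ≡⟨ treePart-punchIn y t ⟨
    treePart y (punchIn v t)   ≡⟨ balanced-tree⇒constant {x = treePart y} sg tree tree-balanced (punchIn v t) v ⟩
    treePart y v               ≡⟨ treePart-v y ⟩
    y (u ↑ˡ k)                 ∎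
    where
    tree-balanced : Balanced T (treePart y)
    tree-balanced = balanced-punchIn {A = T} {x = treePart y} (IsSignedGraph.symmetric sg) v
      (λ t′ → trans (sym (netFlow-↑ʳ y t′)) (bal (n ↑ʳ t′)))

  restrict-balanced : IsSignedGraph T → IsTree T → ∀ y → Balanced Γ y → Balanced A (restrict y)
  restrict-balanced sg tree y bal a =
    trans (sym (netFlow-↑ˡ y (balanced⇒treeConstant sg tree y bal) a)) (bal (a ↑ˡ k))

  kernelIsomorphism : IsSignedGraph T → IsTree T → KernelIsomorphism (netLaplacian Γ) (netLaplacian A)
  kernelIsomorphism sg tree = record
    { to           = restrict
    ; from         = extend
    ; to-kernel    = λ y y-kernel →
        balanced⇒inKernel A (restrict-balanced sg tree y (inKernel⇒balanced Γ y-kernel))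
    ; from-kernel  = λ x x-kernel → balanced⇒inKernel Γ (extend-balanced x (inKernel⇒balanced A x-kernel))
    ; to-cong      = λ y≗y′ a → y≗y′ (a ↑ˡ k)
    ; from-cong    = extend-cong
    ; to-lincomb   = λ _ _ _ → refl
    ; from-lincomb = extend-lincomb
    ; from-to      = λ y y-kernel →
        extend-restrict (balanced⇒treeConstant sg tree y (inKernel⇒balanced Γ y-kernel))
    ; to-from      = λ x _ → restrict-extend x
    }

corollary3p5 : ∀ {n k : ℕ} (A₁ : Adjacency n) (T : Adjacency (suc k)) →
    IsSignedGraph A₁ → IsSignedGraph T → IsTree T →
    (u : Fin n) (v : Fin (suc k)) →
    ∀ (d : ℕ) → η≡ (coalesce A₁ T u v) d ⇔ η≡ A₁ d
corollary3p5 A₁ T _ T-signed T-tree u v =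
  isNullity-⇔ (Coalescence.kernelIsomorphism A₁ T u v T-signed T-tree)
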